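{- For $m\ge 0$ and $n\ge m+3$, $D^{sc}_f(Q_n;Q_m)\le n+1$.
   Context: The $n$-dimensional hypercube $Q_n$ is the graph whose vertices are the binary strings of length $n$, two vertices being adjacent iff they differ in exactly one position; $Q_0$ is a single vertex. The diameter of a graph is the maximum graph distance between two of its vertices. For $0\le k\le n$, a $k$-subcube of $Q_n$ is a vertex set $U\subseteq V(Q_n)$ whose induced subgraph is isomorphic to $Q_k$. $\kappa^{sc}(Q_n;Q_m)$ is the minimum number of pairwise disjoint vertex sets, each a $k$-subcube of $Q_n$ for some $0\le k\le m$, whose deletion disconnects $Q_n$. $D^{sc}_f(Q_n;Q_m)$ is the maximum diameter of $Q_n-\bigcup\mathcal{F}$ over all families $\mathcal{F}$ of at most $\kappa^{sc}(Q_n;Q_m)-1$ pairwise disjoint vertex sets, each a $k$-subcube of $Q_n$ for some $0\le k\le m$. -}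

module Defs where

open import Data.Bool using (Bool; true; false; T; _xor_)
open import Data.Nat using (ℕ; zero; suc; _+_; _≤_; _<_)
open import Data.Vec using (Vec; []; _∷_)
open import Data.List using (List; length)
open import Data.List.Relation.Unary.All using (All)
open import Data.List.Relation.Unary.AllPairs using (AllPairs)
open import Data.Product using (Σ; ∃; ∃-syntax; _×_; _,_)
open import Function.Bundles using (_⇔_)
open import Function.Definitions using (Injective)
open import Relation.Binary.PropositionalEquality using (_≡_)
open import Relation.Nullary using (¬_)
open import Data.Empty using (⊥)

Vertex : ℕ → Set
Vertex n = Vec Bool n

ham : ∀ {n} → Vertex n → Vertex n → ℕ
ham [] [] = 0
ham (true  ∷ u) (true  ∷ v) = ham u v
ham (false ∷ u) (false ∷ v) = ham u v
ham (true  ∷ u) (false ∷ v) = suc (ham u v)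
ham (false ∷ u) (true  ∷ v) = suc (ham u v)

Adj : ∀ {n} → Vertex n → Vertex n → Set
Adj u v = ham u v ≡ 1

VSet : ℕ → Set
VSet n = Vertex n → Bool

_∈ᵥ_ : ∀ {n} → Vertex n → VSet n → Set
v ∈ᵥ U = T (U v)

IsSubcube : ∀ {n} → ℕ → VSet n → Set
IsSubcube {n} k U =
  Σ (Vertex k → Vertex n) λ f →
      Injective _≡_ _≡_ f
    × (∀ x → f x ∈ᵥ U)
    × (∀ v → v ∈ᵥ U → ∃[ x ] f x ≡ v)
    × (∀ x y → Adj x y ⇔ Adj (f x) (f y))

Disjoint : ∀ {n} → VSet n → VSet n → Set
Disjoint U V = ∀ v → v ∈ᵥ U → v ∈ᵥ V → ⊥

Admissible : ∀ {n} → ℕ → List (VSet n) → Set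
Admissible m F =
  All (λ U → ∃[ k ] (k ≤ m × IsSubcube k U)) F × AllPairs Disjoint F

Rem : ∀ {n} → List (VSet n) → Vertex n → Set
Rem F v = All (λ U → ¬ (v ∈ᵥ U)) F

data Walk {n} (R : Vertex n → Set) : Vertex n → Vertex n → ℕ → Set where
  here : ∀ {u} → R u → Walk R u u 0
  step : ∀ {u w v k} → R u → Adj u w → Walk R w v k → Walk R u v (suc k)

Disconnects : ∀ {n} → List (VSet n) → Set
Disconnects F =
  ∃[ u ] ∃[ v ] (Rem F u × Rem F v × ¬ (∃[ k ] Walk (Rem F) u v k))

IsKappaSC : ℕ → ℕ → ℕ → Set
IsKappaSC n m c =
    (∃[ F ] (Admissible {n} m F × length F ≡ c × Disconnects F))
  × (∀ (F : List (VSet n)) → Admissible m F → Disconnects F → c ≤ length F)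

DiamLe : ∀ {n} → List (VSet n) → ℕ → Set
DiamLe F d = ∀ u v → Rem F u → Rem F v → ∃[ k ] (k ≤ d × Walk (Rem F) u v k)

{-# OPTIONS --safe #-}
module Submission where

-- A k-subcube of Q_n is a face: the vertices with prescribed values on n - k coordinates. The
-- n - m m-subcubes adjacent to a fixed m-subcube cut it off, so κ ≤ n - m, and every face of F has
-- codimension greater than |F|. In Q_n minus such a sparse family of faces, by induction on n,
--  * antipodal vertices u, v are joined by a geodesic: some first step keeps u alive and leaves a
--    face behind in the half-cube of v, because a face H containing a neighbour of u fixes at least
--    |F| coordinates agreeing with u, while a face missing u contains at most one neighbour of u;
--  * vertices agreeing in a coordinate c are joined inside their half-cube, unless no face misses
--    it; then every face admitting the other half is free at c, and going through that half costs
--    two extra steps but leaves a family with fewer faces and no smaller codimensions.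

open import Defs
open import Data.Bool using (Bool; true; false; not; _≟_)
open import Data.Bool.Properties using (not-involutive; ¬-not; not-¬)
open import Data.Fin using (Fin; zero; suc) renaming (_≟_ to _≟ᶠ_)
open import Data.Fin.Properties using (any?)
open import Data.Fin.Subset using (Subset; inside; outside; _∪_; _∩_; ∁; ⁅_⁆; _⊆_; ∣_∣) renaming (_∈_ to _∈ˢ_)
open import Data.Fin.Subset.Properties
  using (∣p∣≤∣x∷p∣; p⊆q⇒∣p∣≤∣q∣; ∣⁅x⁆∣≡1; ∣⊥∣≡0; Empty-unique; x∈⁅x⁆; x≢y⇒x∉⁅y⁆; x∉⁅y⁆⇒x≢y;
         x∈p∪q⁺; x∈p∩q⁺; x∈p∩q⁻; x∉p⇒x∈∁p; x∈∁p⇒x∉p)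
  renaming (_∈?_ to _∈ˢ?_)
open import Data.List using (List; []; _∷_; length; filter; tabulate)
import Data.List as List
open import Data.List.Properties using (length-map; length-filter; filter-notAll; length-tabulate)
open import Data.List.Membership.Propositional using (find; lose)
open import Data.List.Relation.Unary.All using (All; []; _∷_)
import Data.List.Relation.Unary.All as All
open import Data.List.Relation.Unary.All.Properties using (all-filter; filter⁺; filter⁻; ¬All⇒Any¬)
import Data.List.Relation.Unary.All.Properties as All
import Data.List.Relation.Unary.AllPairs.Properties as AllPairs
open import Data.List.Relation.Unary.Any using (Any; here; there)
import Data.List.Relation.Unary.Any as Any
open import Data.List.Relation.Unary.Any.Properties using (¬Any[])
open import Data.Maybe using (Maybe; just; nothing; is-just)
import Data.Maybe.Properties as Maybe
open import Data.Nat using (ℕ; zero; suc; _+_; _≤_; _<_; z≤n; s≤s)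
open import Data.Nat.Properties
  using (≤-refl; ≤-reflexive; ≤-trans; ≤-<-trans; <-≤-trans; ≤-pred; n≤1+n; m≤n⇒m≤1+n; <⇒≱; 0≢1+n;
         suc-injective; +-assoc; +-comm; +-suc; +-monoʳ-≤; +-monoˡ-≤; +-cancelˡ-≤; m≤n⇒∃[o]m+o≡n;
         module ≤-Reasoning)
open import Data.Product using (∃; ∃-syntax; _×_; _,_; proj₁; proj₂)
import Data.Product as Product
open import Data.Sum using (_⊎_; inj₁; inj₂)
import Data.Sum as Sum
open import Data.Vec
  using (Vec; []; _∷_; replicate; take; drop; lookup; map; updateAt; insertAt; removeAt; _++_; _[_]≔_)
import Data.Vec as Vec
open import Data.Vec.Properties
  using (∷-injectiveʳ; ++-injectiveˡ; ++-injectiveʳ; take++drop≡id; insertAt-removeAt; lookup-map;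
         lookup∘updateAt; lookup∘updateAt′; updateAt-updateAt-local; updateAt-id)
import Data.Vec.Properties as Vec
open import Data.Vec.Relation.Binary.Pointwise.Inductive as Pointwise using (Pointwise; []; _∷_)
open import Function using (_∘_; id; case_of_)
open import Function.Bundles using (_⇔_; mk⇔; Equivalence)
open Equivalence using (to; from)
open import Function.Definitions using (Injective)
open import Relation.Binary.PropositionalEquality
  using (_≡_; _≢_; refl; sym; trans; cong; cong₂; subst; subst₂; module ≡-Reasoning)
open import Relation.Nullary using (¬_; ¬?; Dec; yes; no; contradiction; _×-dec_)
open import Relation.Nullary.Decidable using (decidable-stable; isYes; toWitness; fromWitness)

private variable
  n : ℕ

ham-refl : ∀ (x : Vertex n) → ham x x ≡ 0
ham-refl [] = refl
ham-refl (true ∷ x) = ham-refl x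
ham-refl (false ∷ x) = ham-refl x

ham-comm : ∀ (x y : Vertex n) → ham x y ≡ ham y x
ham-comm [] [] = refl
ham-comm (true ∷ x) (true ∷ y) = ham-comm x y
ham-comm (false ∷ x) (false ∷ y) = ham-comm x y
ham-comm (true ∷ x) (false ∷ y) = cong suc (ham-comm x y)
ham-comm (false ∷ x) (true ∷ y) = cong suc (ham-comm x y)

ham≡0⇒≡ : ∀ (x y : Vertex n) → ham x y ≡ 0 → x ≡ y
ham≡0⇒≡ [] [] _ = refl
ham≡0⇒≡ (true ∷ x) (true ∷ y) d = cong (true ∷_) (ham≡0⇒≡ x y d)
ham≡0⇒≡ (false ∷ x) (false ∷ y) d = cong (false ∷_) (ham≡0⇒≡ x y d)

ham-cons : ∀ {n} b (x y : Vertex n) → ham (b ∷ x) (b ∷ y) ≡ ham x y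
ham-cons true x y = refl
ham-cons false x y = refl

ham-insertAt : ∀ (c : Fin (suc n)) b (x y : Vertex n) → ham (insertAt x c b) (insertAt y c b) ≡ ham x y
ham-insertAt zero b x y = ham-cons b x y
ham-insertAt (suc c) b (true ∷ x) (true ∷ y) = ham-insertAt c b x y
ham-insertAt (suc c) b (false ∷ x) (false ∷ y) = ham-insertAt c b x y
ham-insertAt (suc c) b (true ∷ x) (false ∷ y) = cong suc (ham-insertAt c b x y)
ham-insertAt (suc c) b (false ∷ x) (true ∷ y) = cong suc (ham-insertAt c b x y)

ham-++ : ∀ {r m} (a b : Vertex r) (x y : Vertex m) → ham (a ++ x) (b ++ y) ≡ ham a b + ham x y
ham-++ [] [] x y = refl
ham-++ (true ∷ a) (true ∷ b) x y = ham-++ a b x y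
ham-++ (false ∷ a) (false ∷ b) x y = ham-++ a b x y
ham-++ (true ∷ a) (false ∷ b) x y = cong suc (ham-++ a b x y)
ham-++ (false ∷ a) (true ∷ b) x y = cong suc (ham-++ a b x y)

Adj-sym : ∀ (x y : Vertex n) → Adj x y → Adj y x
Adj-sym x y = trans (ham-comm y x)

flip : Fin n → Vertex n → Vertex n
flip i x = updateAt x i not

lookup-flip : ∀ (i : Fin n) (x : Vertex n) → lookup (flip i x) i ≡ not (lookup x i)
lookup-flip i x = lookup∘updateAt i x

lookup-flip′ : ∀ {i j : Fin n} (x : Vertex n) → j ≢ i → lookup (flip i x) j ≡ lookup x j
lookup-flip′ {i = i} {j} x j≢i = lookup∘updateAt′ j i j≢i x

flip-involutive : ∀ (i : Fin n) (x : Vertex n) → flip i (flip i x) ≡ x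
flip-involutive i x = trans (updateAt-updateAt-local i x (not-involutive _)) (updateAt-id i x)

Adj-flip : ∀ (i : Fin n) (x : Vertex n) → Adj x (flip i x)
Adj-flip zero (true ∷ x) = cong suc (ham-refl x)
Adj-flip zero (false ∷ x) = cong suc (ham-refl x)
Adj-flip (suc i) (b ∷ x) = trans (ham-cons b x (flip i x)) (Adj-flip i x)

Adj⇒flip : ∀ (x y : Vertex n) → Adj x y → ∃[ i ] y ≡ flip i x
Adj⇒flip [] [] ()
Adj⇒flip (true ∷ x) (true ∷ y) a = Product.map suc (cong (true ∷_)) (Adj⇒flip x y a)
Adj⇒flip (false ∷ x) (false ∷ y) a = Product.map suc (cong (false ∷_)) (Adj⇒flip x y a)
Adj⇒flip (true ∷ x) (false ∷ y) a = zero , cong (false ∷_) (sym (ham≡0⇒≡ x y (suc-injective a)))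
Adj⇒flip (false ∷ x) (true ∷ y) a = zero , cong (true ∷_) (sym (ham≡0⇒≡ x y (suc-injective a)))

removeAt-flip : ∀ (i : Fin (suc n)) (x : Vertex (suc n)) → removeAt (flip i x) i ≡ removeAt x i
removeAt-flip zero (b ∷ x) = refl
removeAt-flip (suc zero) (b ∷ c ∷ x) = refl
removeAt-flip (suc (suc i)) (b ∷ c ∷ x) = cong (b ∷_) (removeAt-flip (suc i) (c ∷ x))

removeAt-map : ∀ {A B : Set} (f : A → B) (xs : Vec A (suc n)) (i : Fin (suc n)) →
               removeAt (map f xs) i ≡ map f (removeAt xs i)
removeAt-map f (x ∷ xs) zero = refl
removeAt-map f (x ∷ y ∷ xs) (suc i) = cong (f x ∷_) (removeAt-map f (y ∷ xs) i)

flip-injective : ∀ {i j : Fin n} (x : Vertex n) → flip i x ≡ flip j x → i ≡ j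
flip-injective {i = i} {j} x eq with i ≟ᶠ j
... | yes i≡j = i≡j
... | no i≢j = contradiction (begin
      not (lookup x i)      ≡⟨ sym (lookup-flip i x) ⟩
      lookup (flip i x) i   ≡⟨ cong (λ y → lookup y i) eq ⟩
      lookup (flip j x) i   ≡⟨ lookup-flip′ x i≢j ⟩
      lookup x i            ∎) (not-¬ refl ∘ sym)
  where open ≡-Reasoning

flip-square : ∀ {i j s t : Fin n} (a : Vertex n) → i ≢ j →
              flip s (flip i a) ≡ flip t (flip j a) → s ≡ j ⊎ s ≡ i
flip-square {i = i} {j} {s} {t} a i≢j eq with s ≟ᶠ j | s ≟ᶠ i
... | yes s≡j | _ = inj₁ s≡j
... | no _ | yes s≡i = inj₂ s≡i
... | no s≢j | no s≢i with t ≟ᶠ j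
...   | no t≢j = contradiction (trans (sym lhsʲ) (trans (cong (λ y → lookup y j) eq) rhsʲ)) (not-¬ refl)
  where
  lhsʲ : lookup (flip s (flip i a)) j ≡ lookup a j
  lhsʲ = trans (lookup-flip′ (flip i a) (s≢j ∘ sym)) (lookup-flip′ a (i≢j ∘ sym))
  rhsʲ : lookup (flip t (flip j a)) j ≡ not (lookup a j)
  rhsʲ = trans (lookup-flip′ (flip j a) (t≢j ∘ sym)) (lookup-flip j a)
...   | yes refl =
  contradiction (trans (sym (cong (λ y → lookup y s) (trans eq (flip-involutive j a)))) lhsˢ) (not-¬ refl)
  where
  lhsˢ : lookup (flip s (flip i a)) s ≡ not (lookup a s)
  lhsˢ = trans (lookup-flip s (flip i a)) (cong not (lookup-flip′ a s≢i))

parallel-sides : ∀ {a b a′ b′ : Vertex n} {d d′} → Adj a b → Adj a′ b′ →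
                 a′ ≡ flip d a → b′ ≡ flip d′ b → a′ ≢ b → b′ ≢ a → d ≡ d′
parallel-sides {a = a} {b} {a′} {b′} {d} {d′} ab a′b′ refl refl a′≢b b′≢a
  with Adj⇒flip a b ab | Adj⇒flip a′ b′ a′b′
... | i , refl | t , b′≡ta′ with flip-square a i≢d b′≡ta′
  where
  i≢d : i ≢ d
  i≢d refl = a′≢b refl
... | inj₁ d′≡d = sym d′≡d
... | inj₂ refl = contradiction (flip-involutive i a) b′≢a

agree-or-antipodal : ∀ (u v : Vertex n) → (∃ λ c → lookup u c ≡ lookup v c) ⊎ v ≡ map not u
agree-or-antipodal [] [] = inj₂ refl
agree-or-antipodal (a ∷ u) (b ∷ v) with a ≟ b | agree-or-antipodal u v
... | yes a≡b | _ = inj₁ (zero , a≡b)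
... | no _ | inj₁ (c , u[c]≡v[c]) = inj₁ (suc c , u[c]≡v[c])
... | no a≢b | inj₂ refl = inj₂ (cong (_∷ map not u) (¬-not (a≢b ∘ sym)))

WalkWithin : (Vertex n → Set) → ℕ → Vertex n → Vertex n → Set
WalkWithin R d u v = ∃[ k ] (k ≤ d × Walk R u v k)

module _ {n} {R : Vertex n → Set} where

  within-mono : ∀ {d d′ u v} → d ≤ d′ → WalkWithin R d u v → WalkWithin R d′ u v
  within-mono d≤d′ = Product.map₂ (Product.map₁ (λ k≤d → ≤-trans k≤d d≤d′))

  walk-source : ∀ {x y k} → Walk R x y k → R x
  walk-source (here r) = r
  walk-source (step r _ _) = r

  walk-snoc : ∀ {x y z k} → Walk R x y k → Adj y z → R z → Walk R x z (suc k)
  walk-snoc (here r) a rz = step r a (here rz)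
  walk-snoc (step r a w) a′ rz = step r a (walk-snoc w a′ rz)

  walk-map : ∀ {n′} {R′ : Vertex n′ → Set} (g : Vertex n → Vertex n′) →
             (∀ {x} → R x → R′ (g x)) → (∀ {x y} → Adj x y → Adj (g x) (g y)) →
             ∀ {x y k} → Walk R x y k → Walk R′ (g x) (g y) k
  walk-map g gR gA (here r) = here (gR r)
  walk-map g gR gA (step r a w) = step (gR r) (gA a) (walk-map g gR gA w)

  walk-invariant : (B : Vertex n → Set) → (∀ x y → B x → Adj x y → R y → B y) →
                   ∀ {x y k} → Walk R x y k → B x → B y
  walk-invariant B closed (here _) bx = bx
  walk-invariant B closed (step _ a w) bx = walk-invariant B closed w (closed _ _ bx a (walk-source w))

adj-invariant⇒constant : ∀ {k} {A : Set} (g : Vertex k → A) →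
                         (∀ {x y} → Adj x y → g x ≡ g y) → ∀ x y → g x ≡ g y
adj-invariant⇒constant g inv [] [] = refl
adj-invariant⇒constant g inv (a ∷ x) (b ∷ y) =
  trans (adj-invariant⇒constant (g ∘ (a ∷_)) (λ {x} {y} adj → inv (trans (ham-cons a x y) adj)) x y)
        (across a b)
  where
  across : ∀ a b → g (a ∷ y) ≡ g (b ∷ y)
  across true true = refl
  across false false = refl
  across true false = inv (Adj-flip zero (true ∷ y))
  across false true = inv (Adj-flip zero (false ∷ y))

-- Faces

-- The face p of Q_n consists of the vertices agreeing with p wherever p is not nothing.
Face : ℕ → Set
Face = Vec (Maybe Bool)

data Admits : Maybe Bool → Bool → Set where
  free  : ∀ {b} → Admits nothing b
  fixed : ∀ {b} → Admits (just b) b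

admits? : ∀ m b → Dec (Admits m b)
admits? nothing b = yes free
admits? (just c) b with c ≟ b
... | yes refl = yes fixed
... | no c≢b = no λ { fixed → c≢b refl }

infix 4 _∈ᶠ_ _∉ᶠ_ _∈ᶠ?_

_∈ᶠ_ : Vertex n → Face n → Set
x ∈ᶠ p = Pointwise Admits p x

_∉ᶠ_ : Vertex n → Face n → Set
x ∉ᶠ p = ¬ x ∈ᶠ p

_∈ᶠ?_ : ∀ (x : Vertex n) (p : Face n) → Dec (x ∈ᶠ p)
x ∈ᶠ? p = Pointwise.decidable admits? p x

fixedCoords : Face n → Subset n
fixedCoords = map is-just

codim : Face n → ℕ
codim p = ∣ fixedCoords p ∣

∈ᶠ-insertAt⁺ : ∀ {p : Face (suc n)} {c b} {x : Vertex n} →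
               Admits (lookup p c) b → x ∈ᶠ removeAt p c → insertAt x c b ∈ᶠ p
∈ᶠ-insertAt⁺ {p = _ ∷ _} {c = zero} a x∈p = a ∷ x∈p
∈ᶠ-insertAt⁺ {p = _ ∷ _ ∷ _} {c = suc c} {x = _ ∷ _} a (a₀ ∷ x∈p) = a₀ ∷ ∈ᶠ-insertAt⁺ a x∈p

∈ᶠ-insertAt⁻ : ∀ {p : Face (suc n)} {c b} {x : Vertex n} →
               insertAt x c b ∈ᶠ p → Admits (lookup p c) b × x ∈ᶠ removeAt p c
∈ᶠ-insertAt⁻ {p = _ ∷ _} {c = zero} (a ∷ x∈p) = a , x∈p
∈ᶠ-insertAt⁻ {p = _ ∷ _ ∷ _} {c = suc c} {x = _ ∷ _} (a₀ ∷ m) = Product.map₂ (a₀ ∷_) (∈ᶠ-insertAt⁻ m)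

codim-removeAt : ∀ (p : Face (suc n)) c → codim p ≤ suc (codim (removeAt p c))
codim-removeAt (nothing ∷ p) zero = n≤1+n _
codim-removeAt (just _ ∷ p) zero = ≤-refl
codim-removeAt (nothing ∷ q ∷ p) (suc c) = codim-removeAt (q ∷ p) c
codim-removeAt (just _ ∷ q ∷ p) (suc c) = s≤s (codim-removeAt (q ∷ p) c)

codim-removeAt-free : ∀ (p : Face (suc n)) c → lookup p c ≡ nothing → codim (removeAt p c) ≡ codim p
codim-removeAt-free (nothing ∷ p) zero _ = refl
codim-removeAt-free (nothing ∷ q ∷ p) (suc c) p[c]≡nothing = codim-removeAt-free (q ∷ p) c p[c]≡nothing
codim-removeAt-free (just _ ∷ q ∷ p) (suc c) p[c]≡nothing =
  cong suc (codim-removeAt-free (q ∷ p) c p[c]≡nothing)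

∈ᶠ-free : ∀ {p : Face n} {x} i → x ∈ᶠ p → x ∈ᶠ p [ i ]≔ nothing
∈ᶠ-free zero (_ ∷ x∈p) = free ∷ x∈p
∈ᶠ-free (suc i) (a ∷ x∈p) = a ∷ ∈ᶠ-free i x∈p

flip-∈ᶠ-free : ∀ {p : Face n} {x} i → x ∈ᶠ p → flip i x ∈ᶠ p [ i ]≔ nothing
flip-∈ᶠ-free zero (_ ∷ x∈p) = free ∷ x∈p
flip-∈ᶠ-free (suc i) (a ∷ x∈p) = a ∷ flip-∈ᶠ-free i x∈p

∈ᶠ-free⁻ : ∀ {p : Face n} {x} i → x ∈ᶠ p [ i ]≔ nothing → x ∈ᶠ p ⊎ flip i x ∈ᶠ p
∈ᶠ-free⁻ {p = nothing ∷ _} zero (_ ∷ x∈p) = inj₁ (free ∷ x∈p)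
∈ᶠ-free⁻ {p = just c ∷ _} {x = b ∷ _} zero (_ ∷ x∈p) with c ≟ b
... | yes refl = inj₁ (fixed ∷ x∈p)
... | no c≢b = inj₂ (subst (Admits (just c)) (¬-not c≢b) fixed ∷ x∈p)
∈ᶠ-free⁻ {p = _ ∷ _} (suc i) (a ∷ x∈p) = Sum.map (a ∷_) (a ∷_) (∈ᶠ-free⁻ i x∈p)

codim-free : ∀ (p : Face n) i → codim p ≤ suc (codim (p [ i ]≔ nothing))
codim-free (nothing ∷ p) zero = n≤1+n _
codim-free (just _ ∷ p) zero = ≤-refl
codim-free (nothing ∷ p) (suc i) = codim-free p i
codim-free (just _ ∷ p) (suc i) = s≤s (codim-free p i)

∈ᶠ-point : ∀ (x : Vertex n) → x ∈ᶠ map just x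
∈ᶠ-point [] = []
∈ᶠ-point (_ ∷ x) = fixed ∷ ∈ᶠ-point x

∈ᶠ-point⁻ : ∀ {x y : Vertex n} → y ∈ᶠ map just x → x ≡ y
∈ᶠ-point⁻ {x = []} {y = []} [] = refl
∈ᶠ-point⁻ {x = _ ∷ _} {y = _ ∷ _} (fixed ∷ y∈x) = cong (_ ∷_) (∈ᶠ-point⁻ y∈x)

codim-point : ∀ (x : Vertex n) → codim (map just x) ≡ n
codim-point [] = refl
codim-point (_ ∷ x) = cong suc (codim-point x)

∈ᶠ-fixed : ∀ {p : Face n} {x i} → x ∈ᶠ p → i ∈ˢ fixedCoords p → lookup p i ≡ just (lookup x i)
∈ᶠ-fixed {i = zero} (fixed ∷ _) _ = refl
∈ᶠ-fixed {i = zero} (free ∷ _) ()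
∈ᶠ-fixed {i = suc i} (_ ∷ x∈p) (Vec.there i∈p) = ∈ᶠ-fixed x∈p i∈p

neighbours-in-face : ∀ {p : Face n} {x} {i j} → x ∉ᶠ p → flip i x ∈ᶠ p → flip j x ∈ᶠ p → i ≡ j
neighbours-in-face {x = _ ∷ _} {i = zero} {j = zero} _ _ _ = refl
neighbours-in-face {x = _ ∷ _} {i = zero} {j = suc j} x∉p (_ ∷ x∈p) (a ∷ _) = contradiction (a ∷ x∈p) x∉p
neighbours-in-face {x = _ ∷ _} {i = suc i} {j = zero} x∉p (a ∷ _) (_ ∷ x∈p) = contradiction (a ∷ x∈p) x∉p
neighbours-in-face {x = _ ∷ _} {i = suc i} {j = suc j} x∉p (a ∷ m) (_ ∷ m′) =
  cong suc (neighbours-in-face (x∉p ∘ (a ∷_)) m m′)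

∉ᶠ-antipode : ∀ {p : Face n} {x} → map not x ∉ᶠ p → ∃ λ i → lookup p i ≡ just (lookup x i)
∉ᶠ-antipode {p = []} {x = []} x∉p = contradiction [] x∉p
∉ᶠ-antipode {p = q ∷ _} {x = b ∷ _} x∉p with admits? q (not b)
... | yes a = Product.map suc id (∉ᶠ-antipode (x∉p ∘ (a ∷_)))
... | no ¬a = zero , opposite q ¬a
  where
  opposite : ∀ q → ¬ Admits q (not b) → q ≡ just b
  opposite nothing ¬a = contradiction free ¬a
  opposite (just c) ¬a with c ≟ b
  ... | yes refl = refl
  ... | no c≢b = contradiction (subst (Admits (just c)) (¬-not c≢b) fixed) ¬a

free-admits : ∀ {m b} → m ≡ nothing → Admits m b
free-admits refl = free

admits-both : ∀ {m b} → Admits m b → Admits m (not b) → m ≡ nothing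
admits-both free _ = refl
admits-both {b = true} fixed ()
admits-both {b = false} fixed ()

¬admits-opposite : ∀ {m b} → m ≡ just b → ¬ Admits m (not b)
¬admits-opposite {b = true} refl ()
¬admits-opposite {b = false} refl ()

-- Subcubes are faces

-- Induct on k. Adjacent rungs f (0x) – f (1x) are parallel, so, Q_k being connected, all rungs
-- point in one direction J and the image is the image of the 0-half with coordinate J freed.
image-face : ∀ {k} (f : Vertex k → Vertex n) → Injective _≡_ _≡_ f → (∀ {x y} → Adj x y → Adj (f x) (f y)) →
             ∃ λ p → n ≤ k + codim p × (∀ x → f x ∈ᶠ p) × (∀ v → v ∈ᶠ p → ∃ λ x → f x ≡ v)
image-face {k = zero} f _ _ =
  map just (f []) , ≤-reflexive (sym (codim-point (f []))) , (λ { [] → ∈ᶠ-point (f []) }) ,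
  λ v v∈p → [] , ∈ᶠ-point⁻ v∈p
image-face {n = n} {k = suc k} f inj adj = p₀ [ J ]≔ nothing , bound , members , covered
  where
  f₀ f₁ : Vertex k → Vertex n
  f₀ x = f (false ∷ x)
  f₁ x = f (true ∷ x)

  halves-disjoint : ∀ {x y} → f₁ x ≢ f₀ y
  halves-disjoint eq with inj eq
  ... | ()

  half₀ = image-face f₀ (∷-injectiveʳ ∘ inj) adj
  p₀ = proj₁ half₀
  bound₀ = proj₁ (proj₂ half₀)
  members₀ = proj₁ (proj₂ (proj₂ half₀))
  covered₀ = proj₂ (proj₂ (proj₂ half₀))

  rung : ∀ x → ∃ λ d → f₁ x ≡ flip d (f₀ x)
  rung x = Adj⇒flip (f₀ x) (f₁ x) (adj (Adj-flip zero (false ∷ x)))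

  direction : Vertex k → Fin n
  direction x = proj₁ (rung x)

  direction-invariant : ∀ {x y} → Adj x y → direction x ≡ direction y
  direction-invariant xy =
    parallel-sides (adj xy) (adj xy) (proj₂ (rung _)) (proj₂ (rung _)) halves-disjoint halves-disjoint

  J : Fin n
  J = direction (replicate k false)

  f₁≡flipJ : ∀ x → f₁ x ≡ flip J (f₀ x)
  f₁≡flipJ x = trans (proj₂ (rung x))
    (cong (λ d → flip d (f₀ x)) (adj-invariant⇒constant direction direction-invariant x (replicate k false)))

  bound : n ≤ suc k + codim (p₀ [ J ]≔ nothing)
  bound = ≤-trans bound₀ (≤-trans (+-monoʳ-≤ k (codim-free p₀ J)) (≤-reflexive (+-suc k _)))

  members : ∀ x → f x ∈ᶠ p₀ [ J ]≔ nothing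
  members (false ∷ x) = ∈ᶠ-free J (members₀ x)
  members (true ∷ x) = subst (_∈ᶠ p₀ [ J ]≔ nothing) (sym (f₁≡flipJ x)) (flip-∈ᶠ-free J (members₀ x))

  covered : ∀ v → v ∈ᶠ p₀ [ J ]≔ nothing → ∃ λ x → f x ≡ v
  covered v v∈p with ∈ᶠ-free⁻ J v∈p
  ... | inj₁ v∈p₀ = Product.map (false ∷_) id (covered₀ v v∈p₀)
  ... | inj₂ Jv∈p₀ with covered₀ (flip J v) Jv∈p₀
  ...   | x , f₀x≡Jv = true ∷ x , trans (f₁≡flipJ x) (trans (cong (flip J) f₀x≡Jv) (flip-involutive J v))

subcube⇒face : ∀ {k} {U : VSet n} → IsSubcube k U → ∃ λ p → n ≤ k + codim p × (∀ v → v ∈ᵥ U ⇔ v ∈ᶠ p)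
subcube⇒face {U = U} (f , inj , f∈U , U⊆f , adj⇔) with image-face f inj (Equivalence.to (adj⇔ _ _))
... | p , bound , f∈p , p⊆f = p , bound , λ v → mk⇔
  (λ v∈U → let (x , fx≡v) = U⊆f v v∈U in subst (_∈ᶠ p) fx≡v (f∈p x))
  (λ v∈p → let (x , fx≡v) = p⊆f v v∈p in subst (_∈ᵥ U) fx≡v (f∈U x))

-- Families of faces and their restrictions to half-cubes

Survives : List (Face n) → Vertex n → Set
Survives Fs x = All (x ∉ᶠ_) Fs

survives? : ∀ (Fs : List (Face n)) x → Dec (Survives Fs x)
survives? Fs x = All.all? (λ G → ¬? (x ∈ᶠ? G)) Fs

¬survives⇒covered : ∀ {Fs : List (Face n)} {x} → ¬ Survives Fs x → Any (x ∈ᶠ_) Fs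
¬survives⇒covered {Fs = Fs} {x} ¬sx =
  Any.map (λ {G} → decidable-stable (x ∈ᶠ? G)) (¬All⇒Any¬ (λ G → ¬? (x ∈ᶠ? G)) Fs ¬sx)

CodimAbove : ℕ → List (Face n) → Set
CodimAbove k Fs = All (λ G → k < codim G) Fs

codimAbove-mono : ∀ {j k} {Fs : List (Face n)} → j ≤ k → CodimAbove k Fs → CodimAbove j Fs
codimAbove-mono j≤k = All.map (≤-<-trans j≤k)

admits-at? : ∀ (c : Fin n) b (G : Face n) → Dec (Admits (lookup G c) b)
admits-at? c b G = admits? (lookup G c) b

-- The faces meeting the half-cube {x | x c ≡ b} ≅ Q_n, as faces of that half-cube.
restrict : Fin (suc n) → Bool → List (Face (suc n)) → List (Face n)
restrict c b Fs = List.map (λ G → removeAt G c) (filter (admits-at? c b) Fs)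

module _ {n} (c : Fin (suc n)) (b : Bool) where

  All-restrict⁺ : ∀ {P : Face n → Set} {Fs} →
                  All (λ G → Admits (lookup G c) b → P (removeAt G c)) Fs → All P (restrict c b Fs)
  All-restrict⁺ {Fs = Fs} ps =
    All.map⁺ (All.zipWith (λ (a⇒p , a) → a⇒p a) (filter⁺ (admits-at? c b) ps , all-filter _ Fs))

  All-restrict⁻ : ∀ {P : Face n → Set} {Fs} →
                  All P (restrict c b Fs) → All (λ G → Admits (lookup G c) b → P (removeAt G c)) Fs
  All-restrict⁻ {Fs = Fs} ps = filter⁻ (admits-at? c b)
    (All.map (λ p _ → p) (All.map⁻ ps)) (All.map (λ ¬a a → contradiction a ¬a) (all-filter _ Fs))

  length-restrict≡ : ∀ Fs → length (restrict c b Fs) ≡ length (filter (admits-at? c b) Fs)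
  length-restrict≡ Fs = length-map (λ G → removeAt G c) (filter (admits-at? c b) Fs)

  length-restrict : ∀ Fs → length (restrict c b Fs) ≤ length Fs
  length-restrict Fs = subst (_≤ length Fs) (sym (length-restrict≡ Fs)) (length-filter (admits-at? c b) Fs)

  length-restrict< : ∀ {Fs} → Any (λ G → ¬ Admits (lookup G c) b) Fs → length (restrict c b Fs) < length Fs
  length-restrict< {Fs} some =
    subst (_< length Fs) (sym (length-restrict≡ Fs)) (filter-notAll (admits-at? c b) Fs some)

  survives-insertAt : ∀ {Fs x} → Survives (restrict c b Fs) x → Survives Fs (insertAt x c b)
  survives-insertAt s =
    All.map (λ x∉G′ x∈G → let (a , x∈G′) = ∈ᶠ-insertAt⁻ x∈G in x∉G′ a x∈G′) (All-restrict⁻ s)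

  survives-removeAt : ∀ {Fs y} → All (λ G → Admits (lookup G c) b → Admits (lookup G c) (lookup y c)) Fs →
                      Survives Fs y → Survives (restrict c b Fs) (removeAt y c)
  survives-removeAt {y = y} widen sy = All-restrict⁺ (All.zipWith
    (λ (widen , y∉G) a y′∈G′ → y∉G (subst (_∈ᶠ _) (insertAt-removeAt y c) (∈ᶠ-insertAt⁺ (widen a) y′∈G′)))
    (widen , sy))

  survives-removeAt-inHalf : ∀ {Fs y} → lookup y c ≡ b → Survives Fs y →
                             Survives (restrict c b Fs) (removeAt y c)
  survives-removeAt-inHalf {Fs} y[c]≡b =
    survives-removeAt (All.universal (λ _ → subst (Admits _) (sym y[c]≡b)) Fs)

  codimAbove-restrict : ∀ {k Fs} → CodimAbove (suc k) Fs → CodimAbove k (restrict c b Fs)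
  codimAbove-restrict = All-restrict⁺ ∘ All.map (λ {G} k<G _ → ≤-pred (≤-trans k<G (codim-removeAt G c)))

  codimAbove-restrict-free : ∀ {k Fs} → All (λ G → Admits (lookup G c) b → lookup G c ≡ nothing) Fs →
                             CodimAbove k Fs → CodimAbove k (restrict c b Fs)
  codimAbove-restrict-free frees sparse = All-restrict⁺ (All.zipWith
    (λ {G} (free-at , k<G) a → subst (_ <_) (sym (codim-removeAt-free G c (free-at a))) k<G) (frees , sparse))

  codimAbove-restrict-shrinking : ∀ {Fs} → CodimAbove (length Fs) Fs → Any (λ G → ¬ Admits (lookup G c) b) Fs →
                                  CodimAbove (length (restrict c b Fs)) (restrict c b Fs)
  codimAbove-restrict-shrinking sparse some =
    codimAbove-restrict (codimAbove-mono (length-restrict< some) sparse)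

  through-half : ∀ {Fs u v k} → lookup u c ≡ b → lookup v c ≡ b →
                 Walk (Survives (restrict c b Fs)) (removeAt u c) (removeAt v c) k → Walk (Survives Fs) u v k
  through-half u[c]≡b v[c]≡b W = subst₂ (λ x y → Walk _ x y _) (reinsert u[c]≡b) (reinsert v[c]≡b)
    (walk-map (λ x → insertAt x c b) survives-insertAt (λ {x} {y} → trans (ham-insertAt c b x y)) W)
    where
    reinsert : ∀ {y} → lookup y c ≡ b → insertAt (removeAt y c) c b ≡ y
    reinsert {y} y[c]≡b = trans (cong (insertAt (removeAt y c) c) (sym y[c]≡b)) (insertAt-removeAt y c)

  within-half : ∀ {Fs u v d} → lookup u c ≡ b → lookup v c ≡ b →
                WalkWithin (Survives (restrict c b Fs)) d (removeAt u c) (removeAt v c) →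
                WalkWithin (Survives Fs) d u v
  within-half u[c]≡b v[c]≡b = Product.map₂ (Product.map₂ (through-half u[c]≡b v[c]≡b))

through-opposite-half : ∀ {Fs : List (Face (suc n))} {u v k} c b → lookup u c ≡ b → lookup v c ≡ b →
                        Survives Fs u → Survives Fs v →
                        Walk (Survives (restrict c (not b) Fs)) (removeAt u c) (removeAt v c) k →
                        Walk (Survives Fs) u v (2 + k)
through-opposite-half {Fs = Fs} {u} {v} {k} c b u[c]≡b v[c]≡b su sv W =
  step su (Adj-flip c u)
    (walk-snoc (through-half c (not b) {u = flip c u} {v = flip c v} (flipped u u[c]≡b) (flipped v v[c]≡b) W′)
               (Adj-sym v (flip c v) (Adj-flip c v)) sv)
  where
  flipped : ∀ y → lookup y c ≡ b → lookup (flip c y) c ≡ not b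
  flipped y y[c]≡b = trans (lookup-flip c y) (cong not y[c]≡b)
  W′ : Walk (Survives (restrict c (not b) Fs)) (removeAt (flip c u) c) (removeAt (flip c v) c) k
  W′ = subst₂ (λ x y → Walk _ x y _) (sym (removeAt-flip c u)) (sym (removeAt-flip c v)) W

-- Walks avoiding a sparse family of faces

∣p∪q∣≤∣p∣+∣q∣ : ∀ (p q : Subset n) → ∣ p ∪ q ∣ ≤ ∣ p ∣ + ∣ q ∣
∣p∪q∣≤∣p∣+∣q∣ [] [] = z≤n
∣p∪q∣≤∣p∣+∣q∣ (outside ∷ p) (outside ∷ q) = ∣p∪q∣≤∣p∣+∣q∣ p q
∣p∪q∣≤∣p∣+∣q∣ (outside ∷ p) (inside ∷ q) =
  subst (suc ∣ p ∪ q ∣ ≤_) (sym (+-suc ∣ p ∣ ∣ q ∣)) (s≤s (∣p∪q∣≤∣p∣+∣q∣ p q))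
∣p∪q∣≤∣p∣+∣q∣ (inside ∷ p) (s ∷ q) =
  s≤s (≤-trans (∣p∪q∣≤∣p∣+∣q∣ p q) (+-monoʳ-≤ ∣ p ∣ (∣p∣≤∣x∷p∣ s q)))

-- A face missing x contains at most one neighbour of x.
covered-neighbours≤ : ∀ (Fs : List (Face n)) (S : Subset n) {x} → Survives Fs x →
                      (∀ {i} → i ∈ˢ S → Any (flip i x ∈ᶠ_) Fs) → ∣ S ∣ ≤ length Fs
covered-neighbours≤ {n = n} [] S _ cover =
  ≤-reflexive (trans (cong ∣_∣ (Empty-unique (λ (_ , i∈S) → ¬Any[] (cover i∈S)))) (∣⊥∣≡0 n))
covered-neighbours≤ (G ∷ Fs) S {x} (x∉G ∷ sx) cover with any? (λ i → (i ∈ˢ? S) ×-dec (flip i x ∈ᶠ? G))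
... | no none = m≤n⇒m≤1+n (covered-neighbours≤ Fs S sx cover′)
  where
  cover′ : ∀ {i} → i ∈ˢ S → Any (flip i x ∈ᶠ_) Fs
  cover′ {i} i∈S with cover i∈S
  ... | here xi∈G = contradiction (i , i∈S , xi∈G) none
  ... | there xi∈Fs = xi∈Fs
... | yes (i , i∈S , xi∈G) = begin
    ∣ S ∣               ≤⟨ p⊆q⇒∣p∣≤∣q∣ split ⟩
    ∣ ⁅ i ⁆ ∪ S′ ∣      ≤⟨ ∣p∪q∣≤∣p∣+∣q∣ ⁅ i ⁆ S′ ⟩
    ∣ ⁅ i ⁆ ∣ + ∣ S′ ∣  ≡⟨ cong (_+ ∣ S′ ∣) (∣⁅x⁆∣≡1 i) ⟩
    suc ∣ S′ ∣          ≤⟨ s≤s (covered-neighbours≤ Fs S′ sx cover′) ⟩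
    suc (length Fs)     ∎
  where
  open ≤-Reasoning
  S′ : Subset _
  S′ = S ∩ ∁ ⁅ i ⁆
  split : S ⊆ ⁅ i ⁆ ∪ S′
  split {j} j∈S with j ≟ᶠ i
  ... | yes refl = x∈p∪q⁺ (inj₁ (x∈⁅x⁆ j))
  ... | no j≢i = x∈p∪q⁺ (inj₂ (x∈p∩q⁺ (j∈S , x∉p⇒x∈∁p (x≢y⇒x∉⁅y⁆ j≢i))))
  cover′ : ∀ {j} → j ∈ˢ S′ → Any (flip j x ∈ᶠ_) Fs
  cover′ j∈S′ with x∈p∩q⁻ S (∁ ⁅ i ⁆) j∈S′
  ... | j∈S , j∈∁i with cover j∈S
  ...   | here xj∈G = contradiction (neighbours-in-face x∉G xj∈G xi∈G) (x∉⁅y⁆⇒x≢y (x∈∁p⇒x∉p j∈∁i))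
  ...   | there xj∈Fs = xj∈Fs

good-direction : ∀ (Fs : List (Face (suc n))) {u} →
                 CodimAbove (length Fs) Fs → Survives Fs u → Survives Fs (map not u) →
                 ∃ λ b → Survives Fs (flip b u) ×
                         CodimAbove (length (restrict b (not (lookup u b)) Fs))
                                    (restrict b (not (lookup u b)) Fs)
good-direction [] _ _ _ = zero , [] , []
good-direction Fs@(G ∷ _) {u} sparse su sv with any? (λ j → ¬? (survives? Fs (flip j u)))
... | no all-survive =
  b , decidable-stable (survives? Fs (flip b u)) (λ ¬s → all-survive (b , ¬s)) ,
  codimAbove-restrict-shrinking b _ sparse (here (¬admits-opposite G[b]≡u[b]))
  where
  b = proj₁ (∉ᶠ-antipode (All.head sv))
  G[b]≡u[b] = proj₂ (∉ᶠ-antipode (All.head sv))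
... | yes (j , ¬sj) with find (¬survives⇒covered ¬sj)
...   | H , H∈Fs , uj∈H
  with any? (λ i → Maybe.≡-dec _≟_ (lookup H i) (just (lookup u i)) ×-dec survives? Fs (flip i u))
...     | yes (b , H[b]≡u[b] , sb) =
  b , sb , codimAbove-restrict-shrinking b _ sparse (lose H∈Fs (¬admits-opposite H[b]≡u[b]))
...     | no none =
  contradiction (covered-neighbours≤ Fs (fixedCoords H) su cover) (<⇒≱ (All.lookup sparse H∈Fs))
  where
  cover : ∀ {i} → i ∈ˢ fixedCoords H → Any (flip i u ∈ᶠ_) Fs
  cover {i} i∈H with i ≟ᶠ j
  ... | yes refl = lose H∈Fs uj∈H
  ... | no i≢j =
    ¬survives⇒covered λ si → none (i , trans (∈ᶠ-fixed uj∈H i∈H) (cong just (lookup-flip′ u i≢j)) , si)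

antipodal-walk : ∀ (Fs : List (Face n)) {u} →
                 CodimAbove (length Fs) Fs → Survives Fs u → Survives Fs (map not u) →
                 Walk (Survives Fs) u (map not u) n
antipodal-walk {n = zero} Fs {[]} _ su _ = here su
antipodal-walk {n = suc n} Fs {u} sparse su sv with good-direction Fs sparse su sv
... | b , s[bu] , sparse′ = step su (Adj-flip b u) (through-half b b̄ (lookup-flip b u) (lookup-map b not u) W)
  where
  b̄ = not (lookup u b)
  Fs′ = restrict b b̄ Fs
  W : Walk (Survives Fs′) (removeAt (flip b u) b) (removeAt (map not u) b) n
  W = subst₂ (λ x y → Walk (Survives Fs′) x y n) (sym (removeAt-flip b u)) (sym (removeAt-map not u b))
    (antipodal-walk Fs′ sparse′
      (subst (Survives Fs′) (removeAt-flip b u) (survives-removeAt-inHalf b b̄ (lookup-flip b u) s[bu]))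
      (subst (Survives Fs′) (removeAt-map not u b) (survives-removeAt-inHalf b b̄ (lookup-map b not u) sv)))

diameter≤1+n : ∀ (Fs : List (Face n)) {u v} → CodimAbove (length Fs) Fs → Survives Fs u → Survives Fs v →
               WalkWithin (Survives Fs) (suc n) u v
diameter≤n : ∀ (Fs : List (Face n)) {u v} → CodimAbove (suc (length Fs)) Fs → Survives Fs u → Survives Fs v →
             WalkWithin (Survives Fs) n u v

diameter≤1+n {n = zero} Fs {[]} {[]} _ su _ = 0 , z≤n , here su
diameter≤1+n {n = suc n} Fs {u} {v} sparse su sv with agree-or-antipodal u v
... | inj₂ refl = suc n , n≤1+n _ , antipodal-walk Fs sparse su sv
... | inj₁ (c , u[c]≡v[c]) = via c (lookup u c) refl (sym u[c]≡v[c])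
  where
  via : ∀ c b → lookup u c ≡ b → lookup v c ≡ b → WalkWithin (Survives Fs) (2 + n) u v
  stay : ∀ c b → lookup u c ≡ b → lookup v c ≡ b → CodimAbove (length (restrict c b Fs)) (restrict c b Fs) →
         WalkWithin (Survives Fs) (2 + n) u v
  stay c b u[c]≡b v[c]≡b sparse′ = within-mono (n≤1+n _) (within-half c b u[c]≡b v[c]≡b
    (diameter≤1+n _ sparse′ (survives-removeAt-inHalf c b u[c]≡b su) (survives-removeAt-inHalf c b v[c]≡b sv)))

  via c b u[c]≡b v[c]≡b with All.all? (admits-at? c b) Fs | All.all? (admits-at? c (not b)) Fs
  ... | no ¬all-b | _ =
    stay c b u[c]≡b v[c]≡b (codimAbove-restrict-shrinking c b sparse (¬All⇒Any¬ (admits-at? c b) Fs ¬all-b))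
  ... | yes _ | yes all-b̄ =
    stay c b u[c]≡b v[c]≡b
      (codimAbove-mono (length-restrict c b Fs) (codimAbove-restrict-free c b frees sparse))
    where
    frees : All (λ G → Admits (lookup G c) b → lookup G c ≡ nothing) Fs
    frees = All.map (λ b̄-ok b-ok → admits-both b-ok b̄-ok) all-b̄
  -- Detour through the half x c ≡ not b: some face is left behind and none loses a fixed
  -- coordinate there, so the stronger bound applies and pays for the two extra steps.
  ... | yes all-b | no ¬all-b̄ =
    let (k , k≤n , W) = diameter≤n Fs′ sparse′ (survives′ su) (survives′ sv)
    in 2 + k , s≤s (s≤s k≤n) , through-opposite-half c b u[c]≡b v[c]≡b su sv W
    where
    Fs′ = restrict c (not b) Fs
    frees : All (λ G → Admits (lookup G c) (not b) → lookup G c ≡ nothing) Fs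
    frees = All.map admits-both all-b
    sparse′ : CodimAbove (suc (length Fs′)) Fs′
    sparse′ = codimAbove-mono (length-restrict< c (not b) (¬All⇒Any¬ (admits-at? c (not b)) Fs ¬all-b̄))
                              (codimAbove-restrict-free c (not b) frees sparse)
    survives′ : ∀ {y} → Survives Fs y → Survives Fs′ (removeAt y c)
    survives′ = survives-removeAt c (not b) (All.map (λ free-at b̄-ok → free-admits (free-at b̄-ok)) frees)

diameter≤n {n = zero} Fs {[]} {[]} _ su _ = 0 , z≤n , here su
diameter≤n {n = suc n} Fs {u} {v} sparse su sv with agree-or-antipodal u v
... | inj₂ refl = suc n , ≤-refl , antipodal-walk Fs (codimAbove-mono (n≤1+n _) sparse) su sv
... | inj₁ (c , u[c]≡v[c]) = within-half c b refl v[c]≡b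
      (diameter≤1+n (restrict c b Fs)
                    (codimAbove-mono (length-restrict c b Fs) (codimAbove-restrict c b sparse))
                    (survives-removeAt-inHalf c b refl su) (survives-removeAt-inHalf c b v[c]≡b sv))
  where
  b = lookup u c
  v[c]≡b = sym u[c]≡v[c]

-- κ(Q_(r+m); Q_m) ≤ r

origin : ∀ r → Vertex r
origin r = replicate r false

module _ (r m : ℕ) where

  take-++ : ∀ (a : Vertex r) (x : Vertex m) → take r (a ++ x) ≡ a
  take-++ a x = sym (++-injectiveˡ a (take r (a ++ x)) (sym (take++drop≡id r (a ++ x))))

  ham-take-drop : ∀ (v w : Vertex (r + m)) → ham v w ≡ ham (take r v) (take r w) + ham (drop r v) (drop r w)
  ham-take-drop v w = trans (cong₂ ham (sym (take++drop≡id r v)) (sym (take++drop≡id r w)))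
                            (ham-++ (take r v) (take r w) (drop r v) (drop r w))

  slice : Vertex r → VSet (r + m)
  slice a v = isYes (Vec.≡-dec _≟_ (take r v) a)

  ∈-slice⁻ : ∀ {a v} → v ∈ᵥ slice a → take r v ≡ a
  ∈-slice⁻ = toWitness

  slice-isSubcube : ∀ a → IsSubcube m (slice a)
  slice-isSubcube a =
    (a ++_) , ++-injectiveʳ a a , (λ x → fromWitness (take-++ a x)) ,
    (λ v v∈a → drop r v , trans (cong (_++ drop r v) (sym (∈-slice⁻ v∈a))) (take++drop≡id r v)) ,
    λ x y → mk⇔ (trans (ham-a++ x y)) (trans (sym (ham-a++ x y)))
    where
    ham-a++ : ∀ x y → ham (a ++ x) (a ++ y) ≡ ham x y
    ham-a++ x y = trans (ham-++ a a x y) (cong (_+ ham x y) (ham-refl a))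

  -- The slices over the neighbours of the origin cut the slice over the origin off from the rest.
  neighbourSlices : List (VSet (r + m))
  neighbourSlices = tabulate (λ i → slice (flip i (origin r)))

  neighbourSlices-admissible : Admissible m neighbourSlices
  neighbourSlices-admissible =
    All.tabulate⁺ (λ i → m , ≤-refl , slice-isSubcube (flip i (origin r))) ,
    AllPairs.tabulate⁺ λ i≢j v v∈i v∈j →
      i≢j (flip-injective (origin r) (trans (sym (∈-slice⁻ v∈i)) (∈-slice⁻ v∈j)))

  survives-neighbourSlices : ∀ a x → ¬ Adj (origin r) a → Rem neighbourSlices (a ++ x)
  survives-neighbourSlices a x ¬adj = All.tabulate⁺ λ i a++x∈i →
    ¬adj (subst (Adj (origin r)) (trans (sym (∈-slice⁻ a++x∈i)) (take-++ a x)) (Adj-flip i (origin r)))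

  originSlice-closed : ∀ v w → take r v ≡ origin r → Adj v w → Rem neighbourSlices w → take r w ≡ origin r
  originSlice-closed v w v∈originSlice adj rw with ham (origin r) (take r w) in d | split
    where
    split : ham (origin r) (take r w) + ham (drop r v) (drop r w) ≡ 1
    split = trans (cong (λ t → ham t (take r w) + ham (drop r v) (drop r w)) (sym v∈originSlice))
                  (trans (sym (ham-take-drop v w)) adj)
  ... | zero | _ = sym (ham≡0⇒≡ _ _ d)
  ... | suc zero | _ =
    contradiction (fromWitness (proj₂ (Adj⇒flip (origin r) (take r w) d))) (All.tabulate⁻ rw _)
  ... | suc (suc _) | ()

neighbourSlices-disconnect : ∀ r m → Disconnects (neighbourSlices (2 + r) m)
neighbourSlices-disconnect r m =
  o ++ zeros , a ++ zeros ,
  survives-neighbourSlices (2 + r) m o zeros (λ adj → 0≢1+n (trans (sym (ham-refl o)) adj)) ,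
  survives-neighbourSlices (2 + r) m a zeros (λ ()) ,
  λ (_ , W) →
    case walk-invariant (λ w → take (2 + r) w ≡ o) (originSlice-closed (2 + r) m) W (take-++ (2 + r) m o zeros)
    of λ ()
  where
  o a : Vertex (2 + r)
  o = origin (2 + r)
  a = true ∷ true ∷ replicate r false
  zeros = replicate m false

κ≤r : ∀ r {m c} → IsKappaSC (2 + r + m) m c → c ≤ 2 + r
κ≤r r {m} {c} (_ , minimal) = subst (c ≤_) (length-tabulate (λ i → slice (2 + r) m (flip i (origin (2 + r)))))
  (minimal (neighbourSlices (2 + r) m) (neighbourSlices-admissible (2 + r) m) (neighbourSlices-disconnect r m))

m+κ≤n : ∀ {m n c} → m + 2 ≤ n → IsKappaSC n m c → m + c ≤ n
m+κ≤n {m} {c = c} m+2≤n κ with m≤n⇒∃[o]m+o≡n m+2≤n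
... | o , refl =
  ≤-trans (+-monoʳ-≤ m (κ≤r o (subst (λ n → IsKappaSC n m c) n≡2+o+m κ))) (≤-reflexive (sym (+-assoc m 2 o)))
  where
  n≡2+o+m : m + 2 + o ≡ 2 + o + m
  n≡2+o+m = trans (+-assoc m 2 o) (+-comm m (2 + o))

faces-of : ∀ {m} {F : List (VSet n)} → All (λ U → ∃[ k ] (k ≤ m × IsSubcube k U)) F →
           ∃ λ Ps → length Ps ≡ length F × All (λ p → n ≤ m + codim p) Ps × (∀ v → Rem F v ⇔ Survives Ps v)
faces-of [] = [] , refl , [] , λ _ → mk⇔ (λ _ → []) (λ _ → [])
faces-of ((k , k≤m , U-subcube) ∷ subcubes) with subcube⇒face U-subcube | faces-of subcubes
... | p , n≤k+codim , U⇔p | Ps , same-length , bounds , F⇔Ps =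
  p ∷ Ps , cong suc same-length , ≤-trans n≤k+codim (+-monoˡ-≤ (codim p) k≤m) ∷ bounds ,
  λ v → mk⇔ (λ { (v∉U ∷ rv) → v∉U ∘ from (U⇔p v) ∷ to (F⇔Ps v) rv })
            (λ { (v∉p ∷ sv) → v∉p ∘ to (U⇔p v) ∷ from (F⇔Ps v) sv })

codimAbove-length : ∀ {m c} {Ps : List (Face n)} → length Ps < c → m + c ≤ n →
                    All (λ p → n ≤ m + codim p) Ps → CodimAbove (length Ps) Ps
codimAbove-length {m = m} |Ps|<c m+c≤n =
  All.map λ n≤m+codim → <-≤-trans |Ps|<c (+-cancelˡ-≤ m _ _ (≤-trans m+c≤n n≤m+codim))

lemma4p4 : ∀ (m n : ℕ) → m + 3 ≤ n → ∀ (c : ℕ) → IsKappaSC n m c →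
           ∀ (F : List (VSet n)) → Admissible m F → length F < c →
           DiamLe F (n + 1)
lemma4p4 m n m+3≤n c κ F (subcubes , _) |F|<c u v ru rv =
  let (Ps , same-length , bounds , F⇔Ps) = faces-of subcubes
      m+c≤n = m+κ≤n (≤-trans (+-monoʳ-≤ m (n≤1+n 2)) m+3≤n) κ
      sparse = codimAbove-length (subst (_< c) (sym same-length) |F|<c) m+c≤n bounds
      (k , k≤1+n , W) = diameter≤1+n Ps sparse (to (F⇔Ps u) ru) (to (F⇔Ps v) rv)
  in k , subst (k ≤_) (+-comm 1 n) k≤1+n , walk-map id (λ {x} → from (F⇔Ps x)) id W
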